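{- Define integers $T(k,\mu)$, for integers $k\ge1$ and $0\le\mu\le[(k-1)/2]$, recursively by $T(k,0)=1$ and $$T(k,\mu)=-\sum_{j=1}^{\mu}(-1)^j\binom{k-j}{j}T(k-2j,\mu-j)\qquad(1\le \mu\le[(k-1)/2]).$$ Then for every integer $k\ge1$ and every integer $0\le\mu\le[(k-1)/2]$, $$T(k,\mu)=\frac{k-2\mu+1}{k-\mu+1}\binom{k}{\mu}.$$
   Context: $[x]$ denotes the greatest integer $\le x$. -}

module Defs where

open import Data.Nat as ℕ using (ℕ; zero; suc; _∸_)
open import Data.Nat.Combinatorics using (_C_)
open import Data.Integer as ℤ using (ℤ; +_; -_)
open import Data.List using (List; []; _∷_; head)
open import Data.Maybe using (just; nothing)

sgn : ℕ → ℤ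
sgn zero = + 1
sgn (suc j) = - sgn j

-- Given j and L = [T(·,m), T(·,m-1), …, T(·,0)] (so the i-th entry, counted
-- from j, is T(·, m+1-j')), compute
--   Σ_{j' = j}^{j + length L - 1} (-1)^{j'} C(k-j', j') T(k-2j', m+1-j').
stepSum : ℕ → ℕ → List (ℕ → ℤ) → ℤ
stepSum k j [] = + 0
stepSum k j (f ∷ L) =
  sgn j ℤ.* (+ ((k ∸ j) C j)) ℤ.* f (k ∸ (2 ℕ.* j)) ℤ.+ stepSum k (suc j) L

-- Tlist μ = [T(·,μ), T(·,μ-1), …, T(·,0)], each as a function of k.
-- T(k,0) = 1 and
-- T(k,μ) = - Σ_{j=1}^{μ} (-1)^j C(k-j, j) T(k-2j, μ-j).
Tlist : ℕ → List (ℕ → ℤ)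
Tlist zero = (λ _ → + 1) ∷ []
Tlist (suc m) = (λ k → - stepSum k 1 (Tlist m)) ∷ Tlist m

T : ℕ → ℕ → ℤ
T k μ with head (Tlist μ)
... | just f = f k
... | nothing = + 0

{-# OPTIONS --safe #-}
-- Let B(k, μ) = C(k, μ) − C(k, μ − 1), with B(k, 0) = 1, be the ballot numbers. From
-- μ C(k, μ) = (k − μ + 1) C(k, μ − 1) one gets (k − μ + 1) B(k, μ) = (k − 2μ + 1) C(k, μ),
-- so it suffices to show T = B, i.e. that B satisfies the recursion:
--   Σ_{j=0}^{μ} (−1)^j C(k − j, j) B(k − 2j, μ − j) = 0   for μ ≥ 1, 2μ ≤ k.
-- The subset-of-a-subset identity C(k − j, j) C(k − 2j, r − j) = C(r, j) C(k − j, r) turns the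
-- j-th summand into U_μ(j) − U_{μ−1}(j), where U_r(j) = (−1)^j C(r, j) C(k − j, r), and
-- Σ_j U_r(j) = 1 for r ≤ k because it is the r-th finite difference of C(·, r). So the sum
-- telescopes to 1 − 1 = 0, and strong induction on μ gives T = B.
module Submission where

open import Defs
open import Data.Nat as ℕ using (ℕ; zero; suc; _∸_; _≤_; _<_; _/_; s≤s; z≤n; z<s; _!)
open import Data.Nat.Properties
  using ( +-assoc; +-comm; +-suc; +-identityʳ; *-comm; *-identityʳ; *-distribˡ-+; *-cancelʳ-≡
        ; ≤-reflexive; ≤-trans; ≤-pred; <⇒≤; m≤n⇒m≤1+n; m≤n⇒m<n∨m≡n; m≤n⇒∃[o]m+o≡n
        ; n≤1+n; n<1+n
        ; m≤m+n; m<m+n; +-monoʳ-≤; *-monoˡ-≤; m+n≤o⇒m≤o; m+n≤o⇒m≤o∸n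
        ; m+n∸m≡n; m+n∸n≡m; m∸n+n≡m; m∸n≤m; n∸n≡0; +-∸-assoc; ∸-+-assoc
        ; _!≢0; _!*_!≢0; m*n≢0 )
open import Data.Nat.DivMod using (m/n*n≡m; m/n*n≤m)
open import Data.Nat.Combinatorics
  using ( _C_; nCk≡n!/k![n-k]!; k![n∸k]!∣n!; nCk≡nC[n∸k]; nC1≡n; nCn≡1; k>n⇒nCk≡0
        ; nCk+nC[k+1]≡[n+1]C[k+1] )
open import Data.Nat.Induction using (<-rec)
import Data.Nat.Tactic.RingSolver as ℕ-Solver
open import Data.Integer using (ℤ; +_; 0ℤ; -_; _+_; _-_; _*_)
import Data.Integer.Properties as ℤₚ
import Data.Integer.Tactic.RingSolver as ℤ-Solver
open import Data.Fin using (toℕ)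
open import Data.Fin.Properties using (toℕ<n)
import Data.Rational as ℚ
open import Data.Rational.Properties using (toℚᵘ-injective; toℚᵘ-fromℚᵘ; toℚᵘ-homo-*)
open import Data.Rational.Unnormalised as ℚᵘ using (mkℚᵘ; *≡*)
open import Data.Rational.Unnormalised.Properties using (≃-trans; ≃-sym; *-cong)
open import Data.Product using (_,_)
open import Data.Sum using (inj₁; inj₂)
open import Function using (_∘_)
open import Algebra.Properties.CommutativeMonoid.Sum ℤₚ.+-0-commutativeMonoid
  using (sum-syntax; ∑-distrib-+; sum-cong-≗)
open import Algebra.Properties.AbelianGroup ℤₚ.+-0-abelianGroup using (inverseˡ-unique)
open import Relation.Binary.PropositionalEquality
open ≡-Reasoning

[m+n]Cm*m!*n!≡[m+n]! : ∀ m n → ((m ℕ.+ n) C m) ℕ.* (m ! ℕ.* n !) ≡ (m ℕ.+ n) !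
[m+n]Cm*m!*n!≡[m+n]! m n = begin
  ((m ℕ.+ n) C m) ℕ.* (m ! ℕ.* n !)
    ≡⟨ cong (λ j → ((m ℕ.+ n) C m) ℕ.* (m ! ℕ.* j !)) (sym (m+n∸m≡n m n)) ⟩
  ((m ℕ.+ n) C m) ℕ.* d
    ≡⟨ cong (ℕ._* d) (nCk≡n!/k![n-k]! (m≤m+n m n)) ⟩
  (m ℕ.+ n) ! / d ℕ.* d
    ≡⟨ m/n*n≡m (k![n∸k]!∣n! (m≤m+n m n)) ⟩
  (m ℕ.+ n) ! ∎
  where
  d = m ! ℕ.* (m ℕ.+ n ∸ m) !
  instance _ = m !* (m ℕ.+ n ∸ m) !≢0

[i+a+c]C[i+a]*[i+a]Ci≡[i+a+c]Ci*[a+c]Ca : ∀ i a c →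
  ((i ℕ.+ a ℕ.+ c) C (i ℕ.+ a)) ℕ.* ((i ℕ.+ a) C i) ≡ ((i ℕ.+ a ℕ.+ c) C i) ℕ.* ((a ℕ.+ c) C a)
[i+a+c]C[i+a]*[i+a]Ci≡[i+a+c]Ci*[a+c]Ca i a c =
  *-cancelʳ-≡ _ _ (i ! ℕ.* (a ! ℕ.* c !)) {{m*n≢0 (i !) (a ! ℕ.* c !) {{i !≢0}} {{a !* c !≢0}}}}
    (trans lhs (sym rhs))
  where
  n = i ℕ.+ a ℕ.+ c

  lhs : (n C (i ℕ.+ a)) ℕ.* ((i ℕ.+ a) C i) ℕ.* (i ! ℕ.* (a ! ℕ.* c !)) ≡ n !
  lhs = begin
    (n C (i ℕ.+ a)) ℕ.* ((i ℕ.+ a) C i) ℕ.* (i ! ℕ.* (a ! ℕ.* c !))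
      ≡⟨ regroup (n C (i ℕ.+ a)) ((i ℕ.+ a) C i) (i !) (a !) (c !) ⟩
    (n C (i ℕ.+ a)) ℕ.* (((i ℕ.+ a) C i) ℕ.* (i ! ℕ.* a !) ℕ.* c !)
      ≡⟨ cong (λ x → (n C (i ℕ.+ a)) ℕ.* (x ℕ.* c !)) ([m+n]Cm*m!*n!≡[m+n]! i a) ⟩
    (n C (i ℕ.+ a)) ℕ.* ((i ℕ.+ a) ! ℕ.* c !)
      ≡⟨ [m+n]Cm*m!*n!≡[m+n]! (i ℕ.+ a) c ⟩
    n ! ∎
    where
    regroup : ∀ x y p q r → x ℕ.* y ℕ.* (p ℕ.* (q ℕ.* r)) ≡ x ℕ.* (y ℕ.* (p ℕ.* q) ℕ.* r)
    regroup = ℕ-Solver.solve-∀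

  rhs : (n C i) ℕ.* ((a ℕ.+ c) C a) ℕ.* (i ! ℕ.* (a ! ℕ.* c !)) ≡ n !
  rhs = begin
    (n C i) ℕ.* ((a ℕ.+ c) C a) ℕ.* (i ! ℕ.* (a ! ℕ.* c !))
      ≡⟨ regroup (n C i) ((a ℕ.+ c) C a) (i !) (a ! ℕ.* c !) ⟩
    (n C i) ℕ.* (i ! ℕ.* (((a ℕ.+ c) C a) ℕ.* (a ! ℕ.* c !)))
      ≡⟨ cong (λ x → (n C i) ℕ.* (i ! ℕ.* x)) ([m+n]Cm*m!*n!≡[m+n]! a c) ⟩
    (n C i) ℕ.* (i ! ℕ.* (a ℕ.+ c) !)
      ≡⟨ cong (λ m → (m C i) ℕ.* (i ! ℕ.* (a ℕ.+ c) !)) (+-assoc i a c) ⟩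
    ((i ℕ.+ (a ℕ.+ c)) C i) ℕ.* (i ! ℕ.* (a ℕ.+ c) !)
      ≡⟨ [m+n]Cm*m!*n!≡[m+n]! i (a ℕ.+ c) ⟩
    (i ℕ.+ (a ℕ.+ c)) !
      ≡⟨ cong _! (+-assoc i a c) ⟨
    n ! ∎
    where
    regroup : ∀ x y p q → x ℕ.* y ℕ.* (p ℕ.* q) ≡ x ℕ.* (p ℕ.* (y ℕ.* q))
    regroup = ℕ-Solver.solve-∀

nCr*rCi≡nCi*[n∸i]C[r∸i] : ∀ {i r n} → i ≤ r → r ≤ n →
  (n C r) ℕ.* (r C i) ≡ (n C i) ℕ.* ((n ∸ i) C (r ∸ i))
nCr*rCi≡nCi*[n∸i]C[r∸i] {i} i≤r r≤n with m≤n⇒∃[o]m+o≡n i≤r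
... | a , refl with m≤n⇒∃[o]m+o≡n r≤n
... | c , refl = begin
  ((i ℕ.+ a ℕ.+ c) C (i ℕ.+ a)) ℕ.* ((i ℕ.+ a) C i)
    ≡⟨ [i+a+c]C[i+a]*[i+a]Ci≡[i+a+c]Ci*[a+c]Ca i a c ⟩
  ((i ℕ.+ a ℕ.+ c) C i) ℕ.* ((a ℕ.+ c) C a)
    ≡⟨ cong₂ (λ m j → ((i ℕ.+ a ℕ.+ c) C i) ℕ.* (m C j)) n∸i≡a+c (m+n∸m≡n i a) ⟨
  ((i ℕ.+ a ℕ.+ c) C i) ℕ.* ((i ℕ.+ a ℕ.+ c ∸ i) C (i ℕ.+ a ∸ i)) ∎
  where
  n∸i≡a+c : i ℕ.+ a ℕ.+ c ∸ i ≡ a ℕ.+ c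
  n∸i≡a+c = trans (cong (_∸ i) (+-assoc i a c)) (m+n∸m≡n i (a ℕ.+ c))

[1+k]*nC[1+k]≡[n∸k]*nCk : ∀ {k n} → k < n → suc k ℕ.* (n C suc k) ≡ (n ∸ k) ℕ.* (n C k)
[1+k]*nC[1+k]≡[n∸k]*nCk {k} {n} k<n = begin
  suc k ℕ.* (n C suc k)                 ≡⟨ *-comm (suc k) (n C suc k) ⟩
  (n C suc k) ℕ.* suc k                 ≡⟨ cong ((n C suc k) ℕ.*_) [1+k]Ck≡1+k ⟨
  (n C suc k) ℕ.* (suc k C k)           ≡⟨ nCr*rCi≡nCi*[n∸i]C[r∸i] (n≤1+n k) k<n ⟩
  (n C k) ℕ.* ((n ∸ k) C (suc k ∸ k))   ≡⟨ cong (λ j → (n C k) ℕ.* ((n ∸ k) C j)) (m+n∸n≡m 1 k) ⟩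
  (n C k) ℕ.* ((n ∸ k) C 1)             ≡⟨ cong ((n C k) ℕ.*_) (nC1≡n (n ∸ k)) ⟩
  (n C k) ℕ.* (n ∸ k)                   ≡⟨ *-comm (n C k) (n ∸ k) ⟩
  (n ∸ k) ℕ.* (n C k)                   ∎
  where
  [1+k]Ck≡1+k : suc k C k ≡ suc k
  [1+k]Ck≡1+k = trans (nCk≡nC[n∸k] (n≤1+n k)) (trans (cong (suc k C_) (m+n∸n≡m 1 k)) (nC1≡n (suc k)))

binom : ℕ → ℕ → ℤ
binom n k = + (n C k)

binom-pascal : ∀ n k → binom (suc n) (suc k) ≡ binom n k + binom n (suc k)
binom-pascal n k = trans (cong +_ (sym (nCk+nC[k+1]≡[n+1]C[k+1] n k))) (ℤₚ.pos-+ (n C k) (n C suc k))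

binom-suc-diag : ∀ n → binom n (suc n) ≡ 0ℤ
binom-suc-diag n = cong +_ (k>n⇒nCk≡0 (n<1+n n))

∑< : ℕ → (ℕ → ℤ) → ℤ
∑< n t = ∑[ i < n ] t (toℕ i)

∑<-cong : ∀ n {t u : ℕ → ℤ} → (∀ i → i < n → t i ≡ u i) → ∑< n t ≡ ∑< n u
∑<-cong n t≡u = sum-cong-≗ (λ i → t≡u (toℕ i) (toℕ<n i))

∑<-neg : ∀ n (t : ℕ → ℤ) → ∑< n (λ i → - t i) ≡ - ∑< n t
∑<-neg zero    t = refl
∑<-neg (suc n) t =
  trans (cong (λ s → - t 0 + s) (∑<-neg n (t ∘ suc))) (sym (ℤₚ.neg-distrib-+ (t 0) (∑< n (t ∘ suc))))

∑<-distrib-- : ∀ n (t u : ℕ → ℤ) → ∑< n (λ i → t i - u i) ≡ ∑< n t - ∑< n u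
∑<-distrib-- n t u =
  trans (∑-distrib-+ {n} (t ∘ toℕ) (λ i → - u (toℕ i))) (cong (λ s → ∑< n t + s) (∑<-neg n u))

∑<-init : ∀ n (t : ℕ → ℤ) → t n ≡ 0ℤ → ∑< (suc n) t ≡ ∑< n t
∑<-init zero    t t0≡0 = cong (_+ 0ℤ) t0≡0
∑<-init (suc n) t tn≡0 = cong (λ s → t 0 + s) (∑<-init n (t ∘ suc) tn≡0)

altTerm : ℕ → (ℕ → ℤ) → ℕ → ℤ
altTerm r g i = sgn i * binom r i * g i

altSum : ℕ → (ℕ → ℤ) → ℤ
altSum r g = ∑< (suc r) (altTerm r g)

altTerm-suc-diag : ∀ r g → altTerm r g (suc r) ≡ 0ℤ
altTerm-suc-diag r g = begin
  sgn (suc r) * binom r (suc r) * g (suc r) ≡⟨ cong (λ b → sgn (suc r) * b * g (suc r)) (binom-suc-diag r) ⟩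
  sgn (suc r) * 0ℤ * g (suc r)              ≡⟨ cong (_* g (suc r)) (ℤₚ.*-zeroʳ (sgn (suc r))) ⟩
  0ℤ * g (suc r)                            ≡⟨⟩
  0ℤ                                        ∎

altSum-suc : ∀ r g → altSum (suc r) g ≡ altSum r g - altSum r (g ∘ suc)
altSum-suc r g = begin
  g₀ + ∑< (suc r) (altTerm (suc r) g ∘ suc)
    ≡⟨ cong (λ s → g₀ + s) (∑<-cong (suc r) (λ i _ → altTerm-pascal i)) ⟩
  g₀ + ∑< (suc r) (λ i → altTerm r g (suc i) - altTerm r (g ∘ suc) i)
    ≡⟨ cong (λ s → g₀ + s) (∑<-distrib-- (suc r) (altTerm r g ∘ suc) (altTerm r (g ∘ suc))) ⟩
  g₀ + (∑< (suc r) (altTerm r g ∘ suc) - altSum r (g ∘ suc))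
    ≡⟨ cong (λ s → g₀ + (s - altSum r (g ∘ suc))) (∑<-init r (altTerm r g ∘ suc) (altTerm-suc-diag r g)) ⟩
  g₀ + (∑< r (altTerm r g ∘ suc) - altSum r (g ∘ suc))
    ≡⟨ ℤₚ.+-assoc g₀ _ _ ⟨
  altSum r g - altSum r (g ∘ suc) ∎
  where
  g₀ = altTerm r g 0
  distrib : ∀ s a b x → - s * (a + b) * x ≡ - s * b * x - s * a * x
  distrib = ℤ-Solver.solve-∀
  altTerm-pascal : ∀ i → altTerm (suc r) g (suc i) ≡ altTerm r g (suc i) - altTerm r (g ∘ suc) i
  altTerm-pascal i = trans (cong (λ b → sgn (suc i) * b * g (suc i)) (binom-pascal r i))
                           (distrib (sgn i) (binom r i) (binom r (suc i)) (g (suc i)))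

altSum-binom : ∀ r s K → r ≤ K → altSum r (λ i → binom (K ∸ i) (s ℕ.+ r)) ≡ binom (K ∸ r) s
altSum-binom zero    s K       _         =
  trans (ℤₚ.+-identityʳ _) (trans (ℤₚ.*-identityˡ _) (cong (binom K) (+-identityʳ s)))
altSum-binom (suc r) s (suc K) (s≤s r≤K) rewrite +-suc s r = begin
  altSum (suc r) (λ i → binom (suc K ∸ i) (suc s ℕ.+ r))
    ≡⟨ altSum-suc r (λ i → binom (suc K ∸ i) (suc s ℕ.+ r)) ⟩
  altSum r (λ i → binom (suc K ∸ i) (suc s ℕ.+ r)) - altSum r (λ i → binom (K ∸ i) (suc s ℕ.+ r))
    ≡⟨ cong₂ _-_ (altSum-binom r (suc s) (suc K) (m≤n⇒m≤1+n r≤K)) (altSum-binom r (suc s) K r≤K) ⟩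
  binom (suc K ∸ r) (suc s) - binom (K ∸ r) (suc s)
    ≡⟨ cong (λ n → binom n (suc s) - binom (K ∸ r) (suc s)) (+-∸-assoc 1 r≤K) ⟩
  binom (suc (K ∸ r)) (suc s) - binom (K ∸ r) (suc s)
    ≡⟨ cong (_- binom (K ∸ r) (suc s)) (binom-pascal (K ∸ r) s) ⟩
  binom (K ∸ r) s + binom (K ∸ r) (suc s) - binom (K ∸ r) (suc s)
    ≡⟨ cancel (binom (K ∸ r) s) (binom (K ∸ r) (suc s)) ⟩
  binom (K ∸ r) s ∎
  where
  cancel : ∀ a b → a + b - b ≡ a
  cancel = ℤ-Solver.solve-∀

ballot : ℕ → ℕ → ℤ
ballot n zero    = + 1
ballot n (suc μ) = binom n (suc μ) - binom n μ

ballot-∸ : ∀ n {i m} → i ≤ m → ballot n (suc m ∸ i) ≡ binom n (suc m ∸ i) - binom n (m ∸ i)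
ballot-∸ n i≤m rewrite +-∸-assoc 1 i≤m = refl

ballot-closed : ∀ μ e →
  ballot (2 ℕ.* μ ℕ.+ e) μ * + suc (μ ℕ.+ e) ≡ + (e ℕ.+ 1) * binom (2 ℕ.* μ ℕ.+ e) μ
ballot-closed zero    e = trans (ℤₚ.*-identityˡ (+ suc e)) (trans (cong +_ (+-comm 1 e)) (sym (ℤₚ.*-identityʳ _)))
ballot-closed (suc s) e = begin
  (a₁ - a₀) * X
    ≡⟨ cong ((a₁ - a₀) *_) X≡S+E ⟩
  (a₁ - a₀) * (S + E)
    ≡⟨ expand a₁ a₀ S E ⟩
  E * a₁ + (S * a₁ - (S + E) * a₀)
    ≡⟨ cong (λ x → E * a₁ + (x - (S + E) * a₀)) (trans ratio (cong (_* a₀) X≡S+E)) ⟩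
  E * a₁ + ((S + E) * a₀ - (S + E) * a₀)
    ≡⟨ cancel (E * a₁) ((S + E) * a₀) ⟩
  E * a₁ ∎
  where
  n = 2 ℕ.* suc s ℕ.+ e
  a₁ = binom n (suc s)
  a₀ = binom n s
  S = + suc s
  E = + (e ℕ.+ 1)
  X = + suc (suc s ℕ.+ e)

  n≡s+[2+s+e] : n ≡ s ℕ.+ suc (suc s ℕ.+ e)
  n≡s+[2+s+e] = shape s e
    where
    shape : ∀ s e → 2 ℕ.* suc s ℕ.+ e ≡ s ℕ.+ suc (suc s ℕ.+ e)
    shape = ℕ-Solver.solve-∀

  s<n : s < n
  s<n = subst (s <_) (sym n≡s+[2+s+e]) (m<m+n s z<s)

  n∸s≡2+s+e : n ∸ s ≡ suc (suc s ℕ.+ e)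
  n∸s≡2+s+e = trans (cong (_∸ s) n≡s+[2+s+e]) (m+n∸m≡n s (suc (suc s ℕ.+ e)))

  ratio : S * a₁ ≡ X * a₀
  ratio = begin
    S * a₁                            ≡⟨ ℤₚ.pos-* (suc s) (n C suc s) ⟨
    + (suc s ℕ.* (n C suc s))         ≡⟨ cong +_ ([1+k]*nC[1+k]≡[n∸k]*nCk s<n) ⟩
    + ((n ∸ s) ℕ.* (n C s))           ≡⟨ cong (λ x → + (x ℕ.* (n C s))) n∸s≡2+s+e ⟩
    + (suc (suc s ℕ.+ e) ℕ.* (n C s)) ≡⟨ ℤₚ.pos-* (suc (suc s ℕ.+ e)) (n C s) ⟩
    X * a₀                            ∎

  X≡S+E : X ≡ S + E
  X≡S+E = trans (cong +_ (shape s e)) (ℤₚ.pos-+ (suc s) (e ℕ.+ 1))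
    where
    shape : ∀ s e → suc (suc s ℕ.+ e) ≡ suc s ℕ.+ (e ℕ.+ 1)
    shape = ℕ-Solver.solve-∀

  expand : ∀ a₁ a₀ S E → (a₁ - a₀) * (S + E) ≡ E * a₁ + (S * a₁ - (S + E) * a₀)
  expand = ℤ-Solver.solve-∀
  cancel : ∀ x y → x + (y - y) ≡ x
  cancel = ℤ-Solver.solve-∀

ballot-formula : ∀ {μ k} → 2 ℕ.* μ ≤ k →
  ballot k μ * + suc (k ∸ μ) ≡ + (k ∸ 2 ℕ.* μ ℕ.+ 1) * binom k μ
ballot-formula {μ} 2μ≤k with m≤n⇒∃[o]m+o≡n 2μ≤k
... | e , refl = begin
  ballot k μ * + suc (k ∸ μ)           ≡⟨ cong (λ x → ballot k μ * + suc x) k∸μ≡μ+e ⟩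
  ballot k μ * + suc (μ ℕ.+ e)         ≡⟨ ballot-closed μ e ⟩
  + (e ℕ.+ 1) * binom k μ              ≡⟨ cong (λ x → + (x ℕ.+ 1) * binom k μ) (m+n∸m≡n (2 ℕ.* μ) e) ⟨
  + (k ∸ 2 ℕ.* μ ℕ.+ 1) * binom k μ    ∎
  where
  k = 2 ℕ.* μ ℕ.+ e
  shape : ∀ μ e → 2 ℕ.* μ ℕ.+ e ≡ μ ℕ.+ (μ ℕ.+ e)
  shape = ℕ-Solver.solve-∀
  k∸μ≡μ+e : k ∸ μ ≡ μ ℕ.+ e
  k∸μ≡μ+e = trans (cong (_∸ μ) (shape μ e)) (m+n∸m≡n μ (μ ℕ.+ e))

recursionTerm : (ℕ → ℕ → ℤ) → ℕ → ℕ → ℕ → ℤ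
recursionTerm f k j μ = sgn j * binom (k ∸ j) j * f (k ∸ 2 ℕ.* j) μ

binom-subset-shift : ∀ {i r k} → i ≤ r → r ℕ.+ i ≤ k →
  binom (k ∸ i) i * binom (k ∸ 2 ℕ.* i) (r ∸ i) ≡ binom r i * binom (k ∸ i) r
binom-subset-shift {i} {r} {k} i≤r r+i≤k = begin
  binom (k ∸ i) i * binom (k ∸ 2 ℕ.* i) (r ∸ i)
    ≡⟨ ℤₚ.pos-* ((k ∸ i) C i) ((k ∸ 2 ℕ.* i) C (r ∸ i)) ⟨
  + (((k ∸ i) C i) ℕ.* ((k ∸ 2 ℕ.* i) C (r ∸ i)))
    ≡⟨ cong (λ n → + (((k ∸ i) C i) ℕ.* (n C (r ∸ i)))) k∸i∸i≡k∸2i ⟨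
  + (((k ∸ i) C i) ℕ.* ((k ∸ i ∸ i) C (r ∸ i)))
    ≡⟨ cong +_ (nCr*rCi≡nCi*[n∸i]C[r∸i] i≤r (m+n≤o⇒m≤o∸n r r+i≤k)) ⟨
  + (((k ∸ i) C r) ℕ.* (r C i))
    ≡⟨ cong +_ (*-comm ((k ∸ i) C r) (r C i)) ⟩
  + ((r C i) ℕ.* ((k ∸ i) C r))
    ≡⟨ ℤₚ.pos-* (r C i) ((k ∸ i) C r) ⟩
  binom r i * binom (k ∸ i) r ∎
  where
  k∸i∸i≡k∸2i : k ∸ i ∸ i ≡ k ∸ 2 ℕ.* i
  k∸i∸i≡k∸2i = trans (∸-+-assoc k i i) (cong (λ j → k ∸ (i ℕ.+ j)) (sym (+-identityʳ i)))

recursionTerm-ballot : ∀ {k m i} → i ≤ suc m → suc m ℕ.+ i ≤ k →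
  recursionTerm ballot k i (suc m ∸ i)
    ≡ altTerm (suc m) (λ j → binom (k ∸ j) (suc m)) i - altTerm m (λ j → binom (k ∸ j) m) i
recursionTerm-ballot {k} {m} {i} i≤1+m 1+m+i≤k with m≤n⇒m<n∨m≡n i≤1+m
... | inj₂ refl = begin
  sgn i * binom (k ∸ i) i * ballot (k ∸ 2 ℕ.* i) (i ∸ i)
    ≡⟨ cong (λ μ → sgn i * binom (k ∸ i) i * ballot (k ∸ 2 ℕ.* i) μ) (n∸n≡0 i) ⟩
  sgn i * binom (k ∸ i) i * + 1
    ≡⟨ pad (sgn i) (binom (k ∸ i) i) (binom (k ∸ i) m) ⟩
  sgn i * + 1 * binom (k ∸ i) i - sgn i * 0ℤ * binom (k ∸ i) m
    ≡⟨ cong₂ (λ a b → sgn i * a * binom (k ∸ i) i - sgn i * b * binom (k ∸ i) m)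
             (cong +_ (nCn≡1 i)) (binom-suc-diag m) ⟨
  sgn i * binom i i * binom (k ∸ i) i - sgn i * binom m i * binom (k ∸ i) m ∎
  where
  pad : ∀ s x y → s * x * + 1 ≡ s * + 1 * x - s * 0ℤ * y
  pad = ℤ-Solver.solve-∀
... | inj₁ (s≤s i≤m) = begin
  sgn i * binom (k ∸ i) i * ballot (k ∸ 2 ℕ.* i) (suc m ∸ i)
    ≡⟨ cong (λ b → sgn i * binom (k ∸ i) i * b) (ballot-∸ (k ∸ 2 ℕ.* i) i≤m) ⟩
  sgn i * binom (k ∸ i) i * (binom (k ∸ 2 ℕ.* i) (suc m ∸ i) - binom (k ∸ 2 ℕ.* i) (m ∸ i))
    ≡⟨ distrib (sgn i) (binom (k ∸ i) i) _ _ ⟩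
  sgn i * (binom (k ∸ i) i * binom (k ∸ 2 ℕ.* i) (suc m ∸ i))
    - sgn i * (binom (k ∸ i) i * binom (k ∸ 2 ℕ.* i) (m ∸ i))
    ≡⟨ cong₂ (λ x y → sgn i * x - sgn i * y)
             (binom-subset-shift i≤1+m 1+m+i≤k) (binom-subset-shift i≤m (<⇒≤ 1+m+i≤k)) ⟩
  sgn i * (binom (suc m) i * binom (k ∸ i) (suc m)) - sgn i * (binom m i * binom (k ∸ i) m)
    ≡⟨ reassoc (sgn i) _ _ _ _ ⟩
  sgn i * binom (suc m) i * binom (k ∸ i) (suc m) - sgn i * binom m i * binom (k ∸ i) m ∎
  where
  distrib : ∀ s a x y → s * a * (x - y) ≡ s * (a * x) - s * (a * y)
  distrib = ℤ-Solver.solve-∀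
  reassoc : ∀ s a b x y → s * (a * b) - s * (x * y) ≡ s * a * b - s * x * y
  reassoc = ℤ-Solver.solve-∀

∑-recursionTerm-ballot : ∀ {k m} → 2 ℕ.* suc m ≤ k →
  ∑< (suc (suc m)) (λ i → recursionTerm ballot k i (suc m ∸ i)) ≡ 0ℤ
∑-recursionTerm-ballot {k} {m} 2[1+m]≤k = begin
  ∑< (suc (suc m)) (λ i → recursionTerm ballot k i (suc m ∸ i))
    ≡⟨ ∑<-cong (suc (suc m)) (λ i i<2+m → recursionTerm-ballot (≤-pred i<2+m) (1+m+i≤k (≤-pred i<2+m))) ⟩
  ∑< (suc (suc m)) (λ i → altTerm (suc m) (g (suc m)) i - altTerm m (g m) i)
    ≡⟨ ∑<-distrib-- (suc (suc m)) (altTerm (suc m) (g (suc m))) (altTerm m (g m)) ⟩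
  altSum (suc m) (g (suc m)) - ∑< (suc (suc m)) (altTerm m (g m))
    ≡⟨ cong (λ s → altSum (suc m) (g (suc m)) - s) (∑<-init (suc m) (altTerm m (g m)) (altTerm-suc-diag m (g m))) ⟩
  altSum (suc m) (g (suc m)) - altSum m (g m)
    ≡⟨ cong₂ _-_ (altSum-binom (suc m) 0 k 1+m≤k) (altSum-binom m 0 k (<⇒≤ 1+m≤k)) ⟩
  + 1 - + 1 ∎
  where
  g : ℕ → ℕ → ℤ
  g r j = binom (k ∸ j) r
  1+m+i≤k : ∀ {i} → i ≤ suc m → suc m ℕ.+ i ≤ k
  1+m+i≤k i≤1+m =
    ≤-trans (+-monoʳ-≤ (suc m) i≤1+m) (subst (_≤ k) (cong (suc m ℕ.+_) (+-identityʳ (suc m))) 2[1+m]≤k)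
  1+m≤k : suc m ≤ k
  1+m≤k = m+n≤o⇒m≤o (suc m) (1+m+i≤k z≤n)

ballot-suc : ∀ {k m} → 2 ℕ.* suc m ≤ k →
  ballot k (suc m) ≡ - ∑< (suc m) (λ i → recursionTerm ballot k (suc i) (m ∸ i))
ballot-suc {k} {m} 2[1+m]≤k =
  inverseˡ-unique (ballot k (suc m)) rest (trans (cong (_+ rest) (sym (ℤₚ.*-identityˡ (ballot k (suc m)))))
                                                 (∑-recursionTerm-ballot 2[1+m]≤k))
  where rest = ∑< (suc m) (λ i → recursionTerm ballot k (suc i) (m ∸ i))

stepSum-Tlist : ∀ m k j → stepSum k j (Tlist m) ≡ ∑< (suc m) (λ i → recursionTerm T k (i ℕ.+ j) (m ∸ i))
stepSum-Tlist zero    k j = refl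
stepSum-Tlist (suc m) k j = cong (λ s → recursionTerm T k j (suc m) + s)
  (trans (stepSum-Tlist m k (suc j))
         (∑<-cong (suc m) (λ i _ → cong (λ j′ → recursionTerm T k j′ (m ∸ i)) (+-suc i j))))

T-suc : ∀ k m → T k (suc m) ≡ - ∑< (suc m) (λ i → recursionTerm T k (suc i) (m ∸ i))
T-suc k m = cong -_ (trans (stepSum-Tlist m k 1)
  (∑<-cong (suc m) (λ i _ → cong (λ j → recursionTerm T k j (m ∸ i)) (+-comm i 1))))

2[1+m]<k⇒2[m∸i]<k∸2[1+i] : ∀ {i m k} → i ≤ m → 2 ℕ.* suc m < k → 2 ℕ.* (m ∸ i) < k ∸ 2 ℕ.* suc i
2[1+m]<k⇒2[m∸i]<k∸2[1+i] {i} {m} {k} i≤m 2[1+m]<k =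
  m+n≤o⇒m≤o∸n (suc (2 ℕ.* (m ∸ i))) (subst (λ x → suc x ≤ k) (sym split) 2[1+m]<k)
  where
  split : 2 ℕ.* (m ∸ i) ℕ.+ 2 ℕ.* suc i ≡ 2 ℕ.* suc m
  split = trans (sym (*-distribˡ-+ 2 (m ∸ i) (suc i)))
                (cong (2 ℕ.*_) (trans (+-suc (m ∸ i) i) (cong suc (m∸n+n≡m i≤m))))

T≡ballot : ∀ μ k → 2 ℕ.* μ < k → T k μ ≡ ballot k μ
T≡ballot = <-rec P step
  where
  P : ℕ → Set
  P μ = ∀ k → 2 ℕ.* μ < k → T k μ ≡ ballot k μ
  step : ∀ μ → (∀ {ν} → ν < μ → P ν) → P μ
  step zero    _   k _        = refl
  step (suc m) rec k 2[1+m]<k = begin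
    T k (suc m)
      ≡⟨ T-suc k m ⟩
    - ∑< (suc m) (λ i → recursionTerm T k (suc i) (m ∸ i))
      ≡⟨ cong -_ (∑<-cong (suc m) λ i i<1+m →
           cong (sgn (suc i) * binom (k ∸ suc i) (suc i) *_)
                (rec (s≤s (m∸n≤m m i)) (k ∸ 2 ℕ.* suc i)
                     (2[1+m]<k⇒2[m∸i]<k∸2[1+i] (≤-pred i<1+m) 2[1+m]<k))) ⟩
    - ∑< (suc m) (λ i → recursionTerm ballot k (suc i) (m ∸ i))
      ≡⟨ ballot-suc (<⇒≤ 2[1+m]<k) ⟨
    ballot k (suc m) ∎

t*[1+d]≡a*b⇒t/1≡a/[1+d]*b/1 : ∀ t a b d → t * + suc d ≡ a * b → t ℚ./ 1 ≡ (a ℚ./ suc d) ℚ.* (b ℚ./ 1)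
t*[1+d]≡a*b⇒t/1≡a/[1+d]*b/1 t a b d t[1+d]≡ab =
  toℚᵘ-injective (≃-trans (toℚᵘ-fromℚᵘ (mkℚᵘ t 0)) (≃-trans (*≡* cross) (≃-sym rhs)))
  where
  rhs : ℚ.toℚᵘ ((a ℚ./ suc d) ℚ.* (b ℚ./ 1)) ℚᵘ.≃ mkℚᵘ a d ℚᵘ.* mkℚᵘ b 0
  rhs = ≃-trans (toℚᵘ-homo-* (a ℚ./ suc d) (b ℚ./ 1))
                (*-cong (toℚᵘ-fromℚᵘ (mkℚᵘ a d)) (toℚᵘ-fromℚᵘ (mkℚᵘ b 0)))
  cross : t * ℚᵘ.↧ (mkℚᵘ a d ℚᵘ.* mkℚᵘ b 0) ≡ ℚᵘ.↥ (mkℚᵘ a d ℚᵘ.* mkℚᵘ b 0) * + 1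
  cross = trans (cong (λ x → t * + suc x) (*-identityʳ d)) (trans t[1+d]≡ab (sym (ℤₚ.*-identityʳ (a * b))))

m≤[n∸1]/2⇒2m<n : ∀ {m n} → 1 ≤ n → m ≤ (n ∸ 1) / 2 → 2 ℕ.* m < n
m≤[n∸1]/2⇒2m<n {m} {suc n} _ m≤n/2 =
  s≤s (≤-trans (≤-reflexive (*-comm 2 m)) (≤-trans (*-monoˡ-≤ 2 m≤n/2) (m/n*n≤m n 2)))

theorem2p3 : (k μ : ℕ) → 1 ≤ k → μ ≤ (k ∸ 1) / 2 →
    (T k μ) ℚ./ 1 ≡ ((+ ((k ∸ 2 ℕ.* μ) ℕ.+ 1)) ℚ./ suc (k ∸ μ)) ℚ.* ((+ (k C μ)) ℚ./ 1)
theorem2p3 k μ 1≤k μ≤[k∸1]/2 =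
  t*[1+d]≡a*b⇒t/1≡a/[1+d]*b/1 (T k μ) (+ (k ∸ 2 ℕ.* μ ℕ.+ 1)) (binom k μ) (k ∸ μ) (begin
  T k μ * + suc (k ∸ μ)             ≡⟨ cong (_* + suc (k ∸ μ)) (T≡ballot μ k 2μ<k) ⟩
  ballot k μ * + suc (k ∸ μ)        ≡⟨ ballot-formula {μ} (<⇒≤ 2μ<k) ⟩
  + (k ∸ 2 ℕ.* μ ℕ.+ 1) * binom k μ ∎)
  where
  2μ<k : 2 ℕ.* μ < k
  2μ<k = m≤[n∸1]/2⇒2m<n 1≤k μ≤[k∸1]/2
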